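{- Let $v>k>2$ be integers and let $q$ be a prime power. If there exists an $\mathrm{EA}(q)$-additive $(v,k,1)$-design, then $q$ is a power of a prime divisor of $\frac{v-k}{k-1}$.
   Context: A $(v,k,\lambda)$-design is a pair $(V,\mathcal{B})$ where $V$ is a set of $v$ points and $\mathcal{B}$ is a collection of $k$-subsets of $V$ (blocks) such that every pair of distinct points is contained in exactly $\lambda$ blocks; it is assumed $v>k>2$. $\mathrm{EA}(q)$ denotes the elementary abelian group of order $q$ (the additive group of the field $\mathbb{F}_q$). For an abelian group $G$, a design is $G$-additive if, up to isomorphism, its points are elements of $G$ and every block is zero-sum in $G$ (the sum of its elements is $0$). -}

module Defs where

open import Data.Nat using (ℕ)
open import Data.Nat.Divisibility using (_∣_)
open import Data.Fin using (Fin; toℕ)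
open import Data.Vec using (Vec; lookup)
open import Data.List using (List; length; map)
open import Data.Nat.ListAction using (sum)
open import Data.List.Membership.Propositional using (_∈_)
open import Data.List.Relation.Unary.Unique.Propositional using (Unique)
open import Data.Product using (Σ; _×_)
open import Relation.Binary.PropositionalEquality using (_≡_; _≢_)

-- EA(p^n): the elementary abelian group of order p^n, realised as
-- (ℤ/pℤ)^n = Vec (Fin p) n with componentwise addition modulo p.
EA : ℕ → ℕ → Set
EA p n = Vec (Fin p) n

ZeroSum : {p n : ℕ} → List (EA p n) → Set
ZeroSum {p} {n} B = (i : Fin n) → p ∣ sum (map (λ x → toℕ (lookup x i)) B)

ExactlyOne : {b : ℕ} → (Fin b → Set) → Set
ExactlyOne {b} P = Σ (Fin b) P × ((j j′ : Fin b) → P j → P j′ → j ≡ j′)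

record AdditiveDesign (p n v k : ℕ) : Set where
  field
    points        : List (EA p n)
    points-unique : Unique points
    points-length : length points ≡ v
    b             : ℕ
    block         : Fin b → List (EA p n)
    block-unique  : (j : Fin b) → Unique (block j)
    block-length  : (j : Fin b) → length (block j) ≡ k
    block-sub     : (j : Fin b) (x : EA p n) → x ∈ block j → x ∈ points
    pairs         : (x y : EA p n) → x ∈ points → y ∈ points → x ≢ y →
                    ExactlyOne (λ j → x ∈ block j × y ∈ block j)
    zero-sum      : (j : Fin b) → ZeroSum (block j)

module Submission where

-- Let r be the replication number of a point x (the number of blocks through x)
-- and fix a coordinate g of EA(p^n).  The blocks through x cover every other
-- point exactly once and x itself r times, so adding up their (zero) sums gives
-- S + (r - 1) g(x) ≡ 0 (mod p), where S is the sum of g over all points.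
-- Counting points instead gives r (k - 1) = v - 1, so r does not depend on x
-- and r - 1 = (v - k)/(k - 1).  If p did not divide r - 1, the congruence would
-- determine g(x) mod p, so all points would coincide in every coordinate.
-- Hence p divides (v - k)/(k - 1), and q = p^n is a power of p.

open import Defs
open import Data.Nat.Divisibility using (_∣_)
open import Data.Nat using (ℕ; _*_; _^_; _∸_; _<_; _≤_)
open import Data.Nat.Primality using (Prime)
open import Data.Product using (Σ; _×_)
open import Relation.Binary.PropositionalEquality using (_≡_)

open import Algebra.Properties.CommutativeSemigroup using (interchange)
open import Data.Empty using (⊥-elim)
open import Data.Fin using (Fin; toℕ)
open import Data.Fin.Properties using (toℕ<n; toℕ-injective) renaming (_≟_ to _≟ᶠ_)
open import Data.List using (List; []; _∷_; length; map; allFin)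
open import Data.List.Membership.Propositional using (_∈_; _∉_)
open import Data.List.Membership.Propositional.Properties using (∈-allFin)
open import Data.List.Relation.Binary.Subset.Propositional using (_⊆_)
open import Data.List.Relation.Unary.All using (_∷_)
open import Data.List.Relation.Unary.All.Properties using (All¬⇒¬Any)
open import Data.List.Relation.Unary.AllPairs using (_∷_)
open import Data.List.Relation.Unary.Any using (here; there)
open import Data.List.Relation.Unary.Unique.Propositional using (Unique)
open import Data.List.Relation.Unary.Unique.Propositional.Properties using (allFin⁺)
open import Data.Nat using (zero; suc; _+_; s≤s; z≤n; s≤s⁻¹; NonZero; >-nonZero)
open import Data.Nat.Divisibility using (_∤_; _∣?_; _∣0; ∣m∣n⇒∣m+n; ∣n⇒∣m*n; ∣m+n∣m⇒∣n; >⇒∤)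
open import Data.Nat.ListAction using (sum)
open import Data.Nat.Primality using (euclidsLemma)
open import Data.Nat.Properties
open import Data.Product using (_,_)
open import Data.Sum using (inj₁; inj₂)
open import Data.Vec using (Vec; lookup)
open import Data.Vec.Properties using (tabulate∘lookup; tabulate-cong; ≡-dec)
open import Function using (_∘_)
import Data.List.Membership.DecPropositional as DecMembership
open import Relation.Binary.Definitions using (DecidableEquality)
open import Relation.Binary.PropositionalEquality using (_≢_; refl; sym; trans; cong; cong₂; subst; module ≡-Reasoning)
open import Relation.Nullary using (yes; no)

∑ : {A : Set} → List A → (A → ℕ) → ℕ
∑ xs f = sum (map f xs)

module _ {A : Set} where

  ∑-cong : ∀ xs {f g : A → ℕ} → (∀ {x} → x ∈ xs → f x ≡ g x) → ∑ xs f ≡ ∑ xs g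
  ∑-cong []       _   = refl
  ∑-cong (x ∷ xs) f≗g = cong₂ _+_ (f≗g (here refl)) (∑-cong xs (f≗g ∘ there))

  ∑-zero : (xs : List A) → ∑ xs (λ _ → 0) ≡ 0
  ∑-zero []       = refl
  ∑-zero (_ ∷ xs) = ∑-zero xs

  ∑-one : (xs : List A) → ∑ xs (λ _ → 1) ≡ length xs
  ∑-one []       = refl
  ∑-one (_ ∷ xs) = cong suc (∑-one xs)

  ∑-+ : ∀ xs (f g : A → ℕ) → ∑ xs (λ x → f x + g x) ≡ ∑ xs f + ∑ xs g
  ∑-+ []       f g = refl
  ∑-+ (x ∷ xs) f g = trans (cong (f x + g x +_) (∑-+ xs f g))
                           (interchange +-commutativeSemigroup (f x) (g x) (∑ xs f) (∑ xs g))

  ∑-*ˡ : ∀ xs (f : A → ℕ) a → ∑ xs (λ x → a * f x) ≡ a * ∑ xs f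
  ∑-*ˡ []       f a = sym (*-zeroʳ a)
  ∑-*ˡ (x ∷ xs) f a = trans (cong (a * f x +_) (∑-*ˡ xs f a)) (sym (*-distribˡ-+ a (f x) (∑ xs f)))

  ∑-*ʳ : ∀ xs (f : A → ℕ) a → ∑ xs (λ x → f x * a) ≡ ∑ xs f * a
  ∑-*ʳ []       f a = refl
  ∑-*ʳ (x ∷ xs) f a = trans (cong (f x * a +_) (∑-*ʳ xs f a)) (sym (*-distribʳ-+ a (f x) (∑ xs f)))

  ∑-∣ : ∀ {d} xs (f : A → ℕ) → (∀ x → d ∣ f x) → d ∣ ∑ xs f
  ∑-∣ []       f d∣f = _ ∣0
  ∑-∣ (x ∷ xs) f d∣f = ∣m∣n⇒∣m+n (d∣f x) (∑-∣ xs f d∣f)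

∑-swap : {A B : Set} (xs : List A) (ys : List B) (h : A → B → ℕ) →
         ∑ xs (λ x → ∑ ys (h x)) ≡ ∑ ys (λ y → ∑ xs (λ x → h x y))
∑-swap []       ys h = sym (∑-zero ys)
∑-swap (x ∷ xs) ys h = trans (cong (∑ ys (h x) +_) (∑-swap xs ys h))
                             (sym (∑-+ ys (h x) (λ y → ∑ xs (λ x′ → h x′ y))))

module Kronecker {A : Set} (_≟ᴬ_ : DecidableEquality A) where

  δ : A → A → ℕ
  δ a b with a ≟ᴬ b
  ... | yes _ = 1
  ... | no  _ = 0

  δ-refl : ∀ a → δ a a ≡ 1
  δ-refl a with a ≟ᴬ a
  ... | yes _   = refl
  ... | no  a≢a = ⊥-elim (a≢a refl)

  δ-≢ : ∀ {a b} → a ≢ b → δ a b ≡ 0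
  δ-≢ {a} {b} a≢b with a ≟ᴬ b
  ... | yes a≡b = ⊥-elim (a≢b a≡b)
  ... | no  _   = refl

  δ-sym : ∀ a b → δ a b ≡ δ b a
  δ-sym a b with a ≟ᴬ b
  ... | yes refl = sym (δ-refl a)
  ... | no  a≢b  = sym (δ-≢ (a≢b ∘ sym))

  ∑-δ-∉ : ∀ {b} xs (g : A → ℕ) → b ∉ xs → ∑ xs (λ y → δ y b * g y) ≡ 0
  ∑-δ-∉ []       g _   = refl
  ∑-δ-∉ {b} (y ∷ xs) g b∉ rewrite δ-≢ {y} {b} (λ y≡b → b∉ (here (sym y≡b))) = ∑-δ-∉ xs g (b∉ ∘ there)

  ∑-δ : ∀ {b} xs (g : A → ℕ) → Unique xs → b ∈ xs → ∑ xs (λ y → δ y b * g y) ≡ g b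
  ∑-δ (y ∷ xs) g (y∉ ∷ _) (here refl) rewrite δ-refl y | ∑-δ-∉ xs g (All¬⇒¬Any y∉) =
    trans (+-identityʳ _) (+-identityʳ _)
  ∑-δ {b} (y ∷ xs) g (y∉ ∷ u) (there b∈) rewrite δ-≢ {y} {b} (λ { refl → All¬⇒¬Any y∉ b∈ }) = ∑-δ xs g u b∈

  multiplicity : A → List A → ℕ
  multiplicity a xs = ∑ xs (δ a)

  multiplicity-as-∑-δ : ∀ a xs → multiplicity a xs ≡ ∑ xs (λ y → δ y a * 1)
  multiplicity-as-∑-δ a xs = ∑-cong xs (λ {y} _ → trans (δ-sym a y) (sym (*-identityʳ _)))

  multiplicity-∈ : ∀ {a xs} → Unique xs → a ∈ xs → multiplicity a xs ≡ 1
  multiplicity-∈ {a} {xs} u a∈ = trans (multiplicity-as-∑-δ a xs) (∑-δ xs _ u a∈)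

  multiplicity-∉ : ∀ {a xs} → a ∉ xs → multiplicity a xs ≡ 0
  multiplicity-∉ {a} {xs} a∉ = trans (multiplicity-as-∑-δ a xs) (∑-δ-∉ xs _ a∉)

  open DecMembership _≟ᴬ_ using (_∈?_)

  multiplicity-idem : ∀ a {xs} → Unique xs → multiplicity a xs * multiplicity a xs ≡ multiplicity a xs
  multiplicity-idem a {xs} u with a ∈? xs
  ... | yes a∈ rewrite multiplicity-∈ u a∈ = refl
  ... | no  a∉ rewrite multiplicity-∉ a∉   = refl

  ∑-⊆ : ∀ {xs} ys (g : A → ℕ) → Unique xs → ys ⊆ xs →
        ∑ ys g ≡ ∑ xs (λ a → multiplicity a ys * g a)
  ∑-⊆ {xs} []       g u _  = sym (∑-zero xs)
  ∑-⊆ {xs} (y ∷ ys) g u ⊆xs = begin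
    g y + ∑ ys g
      ≡⟨ cong₂ _+_ (sym (∑-δ xs g u (⊆xs (here refl)))) (∑-⊆ ys g u (⊆xs ∘ there)) ⟩
    ∑ xs (λ a → δ a y * g a) + ∑ xs (λ a → multiplicity a ys * g a)
      ≡⟨ sym (∑-+ xs _ _) ⟩
    ∑ xs (λ a → δ a y * g a + multiplicity a ys * g a)
      ≡⟨ ∑-cong xs (λ {a} _ → sym (*-distribʳ-+ (g a) (δ a y) (multiplicity a ys))) ⟩
    ∑ xs (λ a → multiplicity a (y ∷ ys) * g a)
      ∎
    where open ≡-Reasoning

two-distinct : {A : Set} (xs : List A) → Unique xs → 2 ≤ length xs →
               Σ A (λ x → Σ A (λ y → x ∈ xs × y ∈ xs × x ≢ y))
two-distinct (x ∷ y ∷ _) ((x≢y ∷ _) ∷ _) _       = x , y , here refl , there (here refl) , x≢y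
two-distinct (_ ∷ [])    _                 (s≤s ())

lookup-extensionality : {A : Set} {n : ℕ} {xs ys : Vec A n} → (∀ i → lookup xs i ≡ lookup ys i) → xs ≡ ys
lookup-extensionality {xs = xs} {ys} xs≗ys =
  trans (sym (tabulate∘lookup xs)) (trans (tabulate-cong xs≗ys) (tabulate∘lookup ys))

m∣n∧n<m⇒n≡0 : ∀ {m n} → m ∣ n → n < m → n ≡ 0
m∣n∧n<m⇒n≡0 {n = zero}  _   _   = refl
m∣n∧n<m⇒n≡0 {n = suc _} m∣n n<m = ⊥-elim (>⇒∤ n<m m∣n)

prime-∣-affine-cancel : ∀ {p m s a b} → Prime p → p ∤ m →
                        p ∣ s + m * a → p ∣ s + m * b → b ≤ a → a < p → a ≡ b
prime-∣-affine-cancel {p} {m} {s} {a} {b} prime-p p∤m p∣a p∣b b≤a a<p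
  with euclidsLemma m (a ∸ b) prime-p (∣m+n∣m⇒∣n (subst (p ∣_) split p∣a) p∣b)
  where
  split : s + m * a ≡ (s + m * b) + m * (a ∸ b)
  split = begin
    s + m * a                 ≡⟨ cong (λ t → s + m * t) (sym (m+[n∸m]≡n b≤a)) ⟩
    s + m * (b + (a ∸ b))     ≡⟨ cong (s +_) (*-distribˡ-+ m b (a ∸ b)) ⟩
    s + (m * b + m * (a ∸ b)) ≡⟨ sym (+-assoc s (m * b) (m * (a ∸ b))) ⟩
    (s + m * b) + m * (a ∸ b) ∎
    where open ≡-Reasoning
... | inj₁ p∣m   = ⊥-elim (p∤m p∣m)
... | inj₂ p∣a∸b = ≤-antisym (m∸n≡0⇒m≤n (m∣n∧n<m⇒n≡0 p∣a∸b (≤-<-trans (m∸n≤m a b) a<p))) b≤a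

prime-∣-affine-injective : ∀ {p m s a b} → Prime p → p ∤ m →
                           p ∣ s + m * a → p ∣ s + m * b → a < p → b < p → a ≡ b
prime-∣-affine-injective {a = a} {b} prime-p p∤m p∣a p∣b a<p b<p with ≤-total b a
... | inj₁ b≤a = prime-∣-affine-cancel prime-p p∤m p∣a p∣b b≤a a<p
... | inj₂ a≤b = sym (prime-∣-affine-cancel prime-p p∤m p∣b p∣a a≤b b<p)

m*[1+n]+1≡o+m⇒m*n+1≡o : ∀ m n o → m * suc n + 1 ≡ o + m → m * n + 1 ≡ o
m*[1+n]+1≡o+m⇒m*n+1≡o m n o eq = +-cancelˡ-≡ m _ _ (begin
  m + (m * n + 1) ≡⟨ sym (+-assoc m (m * n) 1) ⟩
  m + m * n + 1   ≡⟨ cong (_+ 1) (sym (*-suc m n)) ⟩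
  m * suc n + 1   ≡⟨ eq ⟩
  o + m           ≡⟨ +-comm o m ⟩
  m + o           ∎)
  where open ≡-Reasoning

module Incidence {p n v k : ℕ} (D : AdditiveDesign p n v k) where

  open AdditiveDesign D

  _≟ᴱ_ : DecidableEquality (EA p n)
  _≟ᴱ_ = ≡-dec _≟ᶠ_

  open Kronecker _≟ᴱ_
  open DecMembership _≟ᴱ_ using (_∈?_)
  private module OnBlocks = Kronecker (_≟ᶠ_ {b})

  blocks : List (Fin b)
  blocks = allFin b

  incidence : EA p n → Fin b → ℕ
  incidence x j = multiplicity x (block j)

  replication : EA p n → ℕ
  replication x = ∑ blocks (incidence x)

  coincidence : EA p n → EA p n → ℕ
  coincidence x y = ∑ blocks (λ j → incidence x j * incidence y j)

  coincidence-diag : ∀ x → coincidence x x ≡ replication x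
  coincidence-diag x = ∑-cong blocks (λ {j} _ → multiplicity-idem x (block-unique j))

  coincidence-≢ : ∀ {x y} → x ∈ points → y ∈ points → x ≢ y → coincidence x y ≡ 1
  coincidence-≢ {x} {y} x∈ y∈ x≢y with pairs x y x∈ y∈ x≢y
  ... | (j₀ , x∈j₀ , y∈j₀) , at-most-one =
    trans (∑-cong blocks indicator) (OnBlocks.∑-δ blocks (λ _ → 1) (allFin⁺ b) (∈-allFin j₀))
    where
    indicator : ∀ {j} → j ∈ blocks → incidence x j * incidence y j ≡ OnBlocks.δ j j₀ * 1
    indicator {j} _ with j ≟ᶠ j₀ | x ∈? block j | y ∈? block j
    ... | yes refl | _ | _
      rewrite multiplicity-∈ (block-unique j) x∈j₀ | multiplicity-∈ (block-unique j) y∈j₀ = refl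
    ... | no j≢j₀  | yes x∈j | yes y∈j = ⊥-elim (j≢j₀ (at-most-one j j₀ (x∈j , y∈j) (x∈j₀ , y∈j₀)))
    ... | no _     | no x∉j  | _      rewrite multiplicity-∉ {x} {block j} x∉j = refl
    ... | no _     | yes _   | no y∉j rewrite multiplicity-∉ {y} {block j} y∉j = *-zeroʳ (incidence x j)

  ∑-blocks-through : ∀ x (g : EA p n → ℕ) →
    ∑ blocks (λ j → incidence x j * ∑ (block j) g) ≡ ∑ points (λ y → coincidence x y * g y)
  ∑-blocks-through x g = begin
    ∑ blocks (λ j → incidence x j * ∑ (block j) g)
      ≡⟨ ∑-cong blocks (λ {j} _ → cong (incidence x j *_) (∑-⊆ (block j) g points-unique (block-sub j _))) ⟩
    ∑ blocks (λ j → incidence x j * ∑ points (λ y → incidence y j * g y))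
      ≡⟨ ∑-cong blocks (λ {j} _ → sym (∑-*ˡ points _ (incidence x j))) ⟩
    ∑ blocks (λ j → ∑ points (λ y → incidence x j * (incidence y j * g y)))
      ≡⟨ ∑-swap blocks points _ ⟩
    ∑ points (λ y → ∑ blocks (λ j → incidence x j * (incidence y j * g y)))
      ≡⟨ ∑-cong points (λ {y} _ → trans (∑-cong blocks (λ {j} _ → sym (*-assoc (incidence x j) _ _)))
                                        (∑-*ʳ blocks _ (g y))) ⟩
    ∑ points (λ y → coincidence x y * g y)
      ∎
    where open ≡-Reasoning

  ∑-coincidence : ∀ {x} → x ∈ points → (g : EA p n → ℕ) →
    ∑ points (λ y → coincidence x y * g y) + g x ≡ ∑ points g + replication x * g x
  ∑-coincidence {x} x∈ g = begin
    ∑ points (λ y → coincidence x y * g y) + g x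
      ≡⟨ cong (∑ points (λ y → coincidence x y * g y) +_) (sym (∑-δ points g points-unique x∈)) ⟩
    ∑ points (λ y → coincidence x y * g y) + ∑ points (λ y → δ y x * g y)
      ≡⟨ sym (∑-+ points _ _) ⟩
    ∑ points (λ y → coincidence x y * g y + δ y x * g y)
      ≡⟨ ∑-cong points split ⟩
    ∑ points (λ y → g y + δ y x * (replication x * g y))
      ≡⟨ ∑-+ points _ _ ⟩
    ∑ points g + ∑ points (λ y → δ y x * (replication x * g y))
      ≡⟨ cong (∑ points g +_) (∑-δ points _ points-unique x∈) ⟩
    ∑ points g + replication x * g x
      ∎
    where
    open ≡-Reasoning
    split : ∀ {y} → y ∈ points →
            coincidence x y * g y + δ y x * g y ≡ g y + δ y x * (replication x * g y)
    split {y} y∈ with y ≟ᴱ x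
    ... | yes refl rewrite coincidence-diag y =
      trans (+-comm (replication y * g y) (g y + 0)) (cong₂ _+_ (+-identityʳ (g y)) (sym (+-identityʳ _)))
    ... | no y≢x rewrite coincidence-≢ x∈ y∈ (y≢x ∘ sym) = +-identityʳ (g y + 0)

  replication-count : ∀ {x} → x ∈ points → replication x * k + 1 ≡ v + replication x
  replication-count {x} x∈ = begin
    replication x * k + 1
      ≡⟨ cong (_+ 1) (sym (∑-*ʳ blocks (incidence x) k)) ⟩
    ∑ blocks (λ j → incidence x j * k) + 1
      ≡⟨ cong (_+ 1) (∑-cong blocks (λ {j} _ → cong (incidence x j *_) block-size)) ⟩
    ∑ blocks (λ j → incidence x j * ∑ (block j) (λ _ → 1)) + 1
      ≡⟨ cong (_+ 1) (∑-blocks-through x (λ _ → 1)) ⟩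
    ∑ points (λ y → coincidence x y * 1) + 1
      ≡⟨ ∑-coincidence x∈ (λ _ → 1) ⟩
    ∑ points (λ _ → 1) + replication x * 1
      ≡⟨ cong₂ _+_ (trans (∑-one points) points-length) (*-identityʳ (replication x)) ⟩
    v + replication x
      ∎
    where
    open ≡-Reasoning
    block-size : ∀ {j} → k ≡ ∑ (block j) (λ _ → 1)
    block-size {j} = sym (trans (∑-one (block j)) (block-length j))

  block-sums-congruence : ∀ {x m} → x ∈ points → replication x ≡ suc m → (g : EA p n → ℕ) →
                          (∀ j → p ∣ ∑ (block j) g) → p ∣ ∑ points g + m * g x
  block-sums-congruence {x} {m} x∈ r≡1+m g p∣block =
    subst (p ∣_) total (∑-∣ blocks _ (λ j → ∣n⇒∣m*n (incidence x j) (p∣block j)))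
    where
    open ≡-Reasoning
    total : ∑ blocks (λ j → incidence x j * ∑ (block j) g) ≡ ∑ points g + m * g x
    total = +-cancelʳ-≡ (g x) _ _ (begin
      ∑ blocks (λ j → incidence x j * ∑ (block j) g) + g x
        ≡⟨ cong (_+ g x) (∑-blocks-through x g) ⟩
      ∑ points (λ y → coincidence x y * g y) + g x
        ≡⟨ ∑-coincidence x∈ g ⟩
      ∑ points g + replication x * g x
        ≡⟨ cong (λ r → ∑ points g + r * g x) r≡1+m ⟩
      ∑ points g + (g x + m * g x)
        ≡⟨ cong (∑ points g +_) (+-comm (g x) (m * g x)) ⟩
      ∑ points g + (m * g x + g x)
        ≡⟨ sym (+-assoc (∑ points g) (m * g x) (g x)) ⟩
      ∑ points g + m * g x + g x
        ∎)

  coordinate : Fin n → EA p n → ℕ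
  coordinate i x = toℕ (lookup x i)

  points-collapse : ∀ {x y m} → Prime p → p ∤ m → x ∈ points → y ∈ points →
                    replication x ≡ suc m → replication y ≡ suc m → x ≡ y
  points-collapse {m = m} prime-p p∤m x∈ y∈ rx≡1+m ry≡1+m = lookup-extensionality λ i → toℕ-injective
    (prime-∣-affine-injective prime-p p∤m (congruence x∈ rx≡1+m i) (congruence y∈ ry≡1+m i)
                              (toℕ<n _) (toℕ<n _))
    where
    congruence : ∀ {z} → z ∈ points → replication z ≡ suc m → ∀ i →
                 p ∣ ∑ points (coordinate i) + m * coordinate i z
    congruence z∈ rz≡1+m i = block-sums-congruence z∈ rz≡1+m (coordinate i) (λ j → zero-sum j i)

module _ {p n v k′ : ℕ} (D : AdditiveDesign p n v (suc k′)) where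

  open AdditiveDesign D
  open Incidence D

  replication-formula : ∀ {x} → x ∈ points → replication x * k′ + 1 ≡ v
  replication-formula x∈ = m*[1+n]+1≡o+m⇒m*n+1≡o _ k′ v (replication-count x∈)

  replication-suc : ∀ {x} → 1 < v → x ∈ points → Σ ℕ (λ m → replication x ≡ suc m)
  replication-suc {x} 1<v x∈ with replication x | replication-formula x∈
  ... | zero  | 1≡v = ⊥-elim (<-irrefl 1≡v 1<v)
  ... | suc m | _   = m , refl

  replication-constant : .{{_ : NonZero k′}} → ∀ {x y} → x ∈ points → y ∈ points →
                         replication x ≡ replication y
  replication-constant x∈ y∈ = *-cancelʳ-≡ _ _ k′
    (+-cancelʳ-≡ 1 _ _ (trans (replication-formula x∈) (sym (replication-formula y∈))))

  additive-design-divisibility : .{{_ : NonZero k′}} → Prime p → 1 < v →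
                                 Σ ℕ (λ m → v ∸ suc k′ ≡ m * k′ × p ∣ m)
  additive-design-divisibility prime-p 1<v
    with two-distinct points points-unique (subst (2 ≤_) (sym points-length) 1<v)
  ... | x , y , x∈ , y∈ , x≢y with replication-suc 1<v x∈
  ... | m , rx≡1+m = m , v∸k≡m*k′ , p∣m
    where
    v∸k≡m*k′ : v ∸ suc k′ ≡ m * k′
    v∸k≡m*k′ = begin
      v ∸ suc k′                      ≡⟨ cong (_∸ suc k′) (sym (replication-formula x∈)) ⟩
      replication x * k′ + 1 ∸ suc k′ ≡⟨ cong (λ r → r * k′ + 1 ∸ suc k′) rx≡1+m ⟩
      k′ + m * k′ + 1 ∸ suc k′        ≡⟨ cong (_∸ suc k′) (+-comm (k′ + m * k′) 1) ⟩
      suc k′ + m * k′ ∸ suc k′        ≡⟨ m+n∸m≡n (suc k′) (m * k′) ⟩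
      m * k′                          ∎
      where open ≡-Reasoning
    p∣m : p ∣ m
    p∣m with p ∣? m
    ... | yes p∣m = p∣m
    ... | no  p∤m = ⊥-elim (x≢y (points-collapse prime-p p∤m x∈ y∈ rx≡1+m
                                   (trans (sym (replication-constant x∈ y∈)) rx≡1+m)))

theorem2p1 : (v k q p n : ℕ) → 2 < k → k < v →
    Prime p → 1 ≤ n → q ≡ p ^ n →
    AdditiveDesign p n v k →
    Σ ℕ (λ r → Prime r × Σ ℕ (λ m → (v ∸ k) ≡ m * (k ∸ 1) × r ∣ m × Σ ℕ (λ e → q ≡ r ^ e)))
theorem2p1 _ zero     _ _ _ () _ _ _ _ _
theorem2p1 v (suc k′) q p n 2<k k<v prime-p _ q≡pⁿ D =
  let m , v∸k≡m*k′ , p∣m = additive-design-divisibility D {{k′≢0}} prime-p 1<v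
  in  p , prime-p , m , v∸k≡m*k′ , p∣m , n , q≡pⁿ
  where
  k′≢0 : NonZero k′
  k′≢0 = >-nonZero (<-trans (s≤s z≤n) (s≤s⁻¹ 2<k))
  1<v : 1 < v
  1<v = <-trans (<-trans (s≤s (s≤s z≤n)) 2<k) k<v
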